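{- Let $(C,X,\operatorname{ex})$ be a reducible configuration, and let $x,y\in X$ be nonadjacent vertices of $C$ with $\operatorname{ex}(x),\operatorname{ex}(y)\ge 1$. Let $C'=C+xy$, $X'=X$, and define $\operatorname{ex}'(v)=\operatorname{ex}(v)$ for $v\notin\{x,y\}$ and $\operatorname{ex}'(v)=\operatorname{ex}(v)-1$ for $v\in\{x,y\}$. Then the configuration $(C',X',\operatorname{ex}')$ is reducible.
   Context: For a graph $G$, a function $f:V(G)\to\mathbb{N}$ and integer $s\ge0$, an $(f,s)$-list-assignment is a list assignment $L$ on $G$ with $|L(v)|\ge f(v)$ for all $v$, $|L(u)\cap L(v)|\le s$ for every edge $uv$, and $L(u)\cap L(v)=\emptyset$ whenever $uv$ is an edge with $f(u)=f(v)=1$. $G$ is $(f,s)$-choosable if it has a proper coloring $\phi$ with $\phi(v)\in L(v)$ for all $v$, for every $(f,s)$-list-assignment $L$. A configuration is a triple $(C,X,\operatorname{ex})$ where $C$ is a plane graph, $X\subseteq V(C)$, and $\operatorname{ex}:V(C)\to\{0,1,2,\infty\}$ (the external degree). Its list-size function is $f(v)=4-\operatorname{ex}(v)$ for $v\in X$ and $f(v)=1$ for $v\notin X$. The configuration is reducible if $C$ is $(f,2)$-choosable. -}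

module Defs where

open import Data.Nat using (ℕ; _≤_; _≟_)
open import Data.Fin using (Fin)
open import Data.Bool using (Bool; true; false)
open import Data.List using (List; length; filter)
open import Data.List.Membership.Propositional using (_∈_)
open import Data.List.Membership.DecPropositional (_≟_) using (_∈?_)
open import Data.List.Relation.Unary.Unique.Propositional using (Unique)
open import Data.Product using (Σ; _×_; _,_)
open import Data.Sum using (_⊎_)
open import Relation.Binary.PropositionalEquality using (_≡_; _≢_)
open import Relation.Nullary using (¬_)

record Graph (n : ℕ) : Set₁ where
  field
    Adj    : Fin n → Fin n → Set
    sym    : ∀ {u v} → Adj u v → Adj v u
    irrefl : ∀ {u} → ¬ Adj u u
open Graph public

addEdge : ∀ {n} → Graph n → (x y : Fin n) → x ≢ y → Graph n
addEdge G x y x≢y = record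
  { Adj    = λ u v → Adj G u v ⊎ ((u ≡ x × v ≡ y) ⊎ (u ≡ y × v ≡ x))
  ; sym    = symE
  ; irrefl = irr
  }
  where
  open import Data.Sum using (inj₁; inj₂)
  open import Relation.Binary.PropositionalEquality using (refl)
  symE : ∀ {u v} → Adj G u v ⊎ ((u ≡ x × v ≡ y) ⊎ (u ≡ y × v ≡ x))
                 → Adj G v u ⊎ ((v ≡ x × u ≡ y) ⊎ (v ≡ y × u ≡ x))
  symE (inj₁ e) = inj₁ (sym G e)
  symE (inj₂ (inj₁ (p , q))) = inj₂ (inj₂ (q , p))
  symE (inj₂ (inj₂ (p , q))) = inj₂ (inj₁ (q , p))
  irr : ∀ {u} → ¬ (Adj G u u ⊎ ((u ≡ x × u ≡ y) ⊎ (u ≡ y × u ≡ x)))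
  irr (inj₁ e) = irrefl G e
  irr (inj₂ (inj₁ (refl , refl))) = x≢y refl
  irr (inj₂ (inj₂ (refl , refl))) = x≢y refl

data Ext : Set where
  e0 e1 e2 e∞ : Ext

data ExtPos : Ext → Set where
  pos1 : ExtPos e1
  pos2 : ExtPos e2
  pos∞ : ExtPos e∞

-- ex(v) - 1 (with ∞ - 1 = ∞; only used when ex(v) ≥ 1)
decr : Ext → Ext
decr e0 = e0
decr e1 = e0
decr e2 = e1
decr e∞ = e∞

-- 4 - ex(v) as a natural number (4 - ∞ truncated to 0)
fourMinus : Ext → ℕ
fourMinus e0 = 4
fourMinus e1 = 3
fourMinus e2 = 2
fourMinus e∞ = 0

record Configuration (n : ℕ) : Set₁ where
  field
    C  : Graph n
    X  : Fin n → Bool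
    ex : Fin n → Ext
open Configuration public

listSize : ∀ {n} → Configuration n → Fin n → ℕ
listSize K v with X K v
... | true  = fourMinus (ex K v)
... | false = 1

-- Lists of colours: finite sets of natural numbers, as duplicate-free lists.
ListAssignment : ℕ → Set
ListAssignment n = Fin n → List ℕ

interSize : List ℕ → List ℕ → ℕ
interSize A B = length (filter (λ c → c ∈? B) A)

record IsFSListAssignment {n : ℕ} (G : Graph n) (f : Fin n → ℕ) (s : ℕ)
                          (L : ListAssignment n) : Set where
  field
    distinct : ∀ v → Unique (L v)
    size     : ∀ v → f v ≤ length (L v)
    smallInt : ∀ u v → Adj G u v → interSize (L u) (L v) ≤ s
    disjoint : ∀ u v → Adj G u v → f u ≡ 1 → f v ≡ 1 →
               ∀ c → c ∈ L u → ¬ (c ∈ L v)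

IsLColouring : ∀ {n} → Graph n → ListAssignment n → (Fin n → ℕ) → Set
IsLColouring G L φ = (∀ v → φ v ∈ L v) × (∀ u v → Adj G u v → φ u ≢ φ v)

FSChoosable : ∀ {n} → Graph n → (Fin n → ℕ) → ℕ → Set
FSChoosable {n} G f s = ∀ (L : ListAssignment n) → IsFSListAssignment G f s L →
                        Σ (Fin n → ℕ) (λ φ → IsLColouring G L φ)

Reducible : ∀ {n} → Configuration n → Set
Reducible K = FSChoosable (C K) (listSize K) 2

addEdgeConf : ∀ {n} (K : Configuration n) (x y : Fin n) → x ≢ y → Configuration n
addEdgeConf K x y x≢y = record
  { C  = addEdge (C K) x y x≢y
  ; X  = X K
  ; ex = λ v → exNew v
  }
  where
  open import Data.Fin using () renaming (_≟_ to _≟F_)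
  open import Relation.Nullary using (yes; no)
  exNew : _ → Ext
  exNew v with v ≟F x | v ≟F y
  ... | yes _ | _     = decr (ex K v)
  ... | no _  | yes _ = decr (ex K v)
  ... | no _  | no _  = ex K v

-- An (f′,2)-list-assignment L of C + xy gives x and y lists sharing at most two
-- colours, so deleting one shared colour from each list (at most one apiece)
-- makes them disjoint.  Lowering ex at x and y raised f there by exactly one
-- (or f = 0 when ex = ∞), so the shrunk assignment is an (f,2)-list-assignment
-- of C; a colouring of C from it is an L-colouring that is also proper on xy.
module Submission where

open import Defs hiding (sym)
open import Data.Nat using (ℕ; suc; pred; _≤_; z≤n; s≤s; _≟_)
open import Data.Nat.Properties using (≤-trans; ≤-reflexive; n≤1+n; pred-mono-≤; pred[n]≤n; module ≤-Reasoning)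
open import Data.Fin using (Fin) renaming (_≟_ to _≟ᶠ_)
open import Data.Bool using (true; false)
open import Data.List using (List; []; _∷_; length; filter)
open import Data.List.Properties using (filter-all; filter-accept; filter-reject)
open import Data.List.Membership.Propositional using (_∈_; _∉_)
open import Data.List.Membership.DecPropositional _≟_ using (_∈?_)
open import Data.List.Membership.Propositional.Properties using (∈-filter⁺; ∈-filter⁻)
open import Data.List.Relation.Unary.Any using (here; there)
open import Data.List.Relation.Unary.All as All using ()
open import Data.List.Relation.Unary.AllPairs using ([]; _∷_)
open import Data.List.Relation.Unary.Unique.Propositional using (Unique)
open import Data.List.Relation.Binary.Sublist.Propositional
  using (_⊆_; []; _∷_; _∷ʳ_; lookup; ⊆-refl)
open import Data.List.Relation.Binary.Sublist.Propositional.Properties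
  using (All-resp-⊆; filter-⊆; filter⁺; length-mono-≤)
open import Data.List.Relation.Binary.Disjoint.Propositional using (Disjoint)
open import Data.Product using (Σ; _×_; _,_; proj₁; proj₂)
open import Data.Sum using (_⊎_; inj₁; inj₂)
open import Data.Empty using (⊥-elim)
open import Function using (_∘_; case_of_)
open import Relation.Binary.PropositionalEquality using (_≡_; _≢_; refl; sym; trans; cong; subst; subst₂; module ≡-Reasoning)
open import Relation.Nullary using (¬_; Dec; yes; no; ¬?)

Unique-resp-⊆ : ∀ {a} {A : Set a} {xs ys : List A} → xs ⊆ ys → Unique ys → Unique xs
Unique-resp-⊆ []         []        = []
Unique-resp-⊆ (_ ∷ʳ τ)   (_ ∷ u)   = Unique-resp-⊆ τ u
Unique-resp-⊆ (refl ∷ τ) (x∉ ∷ u)  = All-resp-⊆ τ x∉ ∷ Unique-resp-⊆ τ u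

interSize-mono : ∀ {A′ A B′ B} → A′ ⊆ A → (∀ {c} → c ∈ B′ → c ∈ B) →
                 interSize A′ B′ ≤ interSize A B
interSize-mono A′⊆A B′⊆B =
  length-mono-≤ (filter⁺ (_∈? _) (_∈? _) (λ { refl → B′⊆B }) A′⊆A)

_≢?_ : (c a : ℕ) → Dec (c ≢ a)
c ≢? a = ¬? (c ≟ a)

delete : ℕ → List ℕ → List ℕ
delete a = filter (_≢? a)

delete-⊆ : ∀ a xs → delete a xs ⊆ xs
delete-⊆ a = filter-⊆ (_≢? a)

∉-delete : ∀ a xs → a ∉ delete a xs
∉-delete a xs a∈ = proj₂ (∈-filter⁻ (_≢? a) {xs = xs} a∈) refl

length-delete : ∀ a {xs} → Unique xs → length xs ≤ suc (length (delete a xs))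
length-delete a {[]}     []       = z≤n
length-delete a {x ∷ xs} (x∉ ∷ u) with x ≟ a
... | yes refl = begin
  suc (length xs)                  ≡⟨ cong (suc ∘ length) (filter-all (_≢? x) (All.map (_∘ sym) x∉)) ⟨
  suc (length (delete x xs))       ≡⟨ cong (suc ∘ length) (filter-reject (_≢? x) {xs = xs} (λ x≢x → x≢x refl)) ⟨
  suc (length (delete x (x ∷ xs))) ∎
  where open ≤-Reasoning
... | no x≢a   = begin
  suc (length xs)                  ≤⟨ s≤s (length-delete a u) ⟩
  suc (suc (length (delete a xs))) ≡⟨ cong (suc ∘ length) (filter-accept (_≢? a) {xs = xs} x≢a) ⟨
  suc (length (delete a (x ∷ xs))) ∎
  where open ≤-Reasoning

Disjoint-if-common-removed : ∀ {A′ A B′ B} → A′ ⊆ A → B′ ⊆ B →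
  (∀ {c} → c ∈ filter (_∈? B) A → c ∉ A′ ⊎ c ∉ B′) → Disjoint A′ B′
Disjoint-if-common-removed A′⊆A B′⊆B removed (c∈A′ , c∈B′)
  with removed (∈-filter⁺ (_∈? _) (lookup A′⊆A c∈A′) (lookup B′⊆B c∈B′))
... | inj₁ c∉A′ = c∉A′ c∈A′
... | inj₂ c∉B′ = c∉B′ c∈B′

record Separation (A B : List ℕ) : Set where
  field
    {left right}  : List ℕ
    left-⊆        : left ⊆ A
    right-⊆       : right ⊆ B
    length-left   : length A ≤ suc (length left)
    length-right  : length B ≤ suc (length right)
    disjoint      : Disjoint left right

separate : ∀ {A B} → Unique A → Unique B → interSize A B ≤ 2 → Separation A B
separate {A} {B} uA uB shared≤2 with filter (_∈? B) A in common
... | [] = record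
  { left-⊆ = ⊆-refl ; right-⊆ = ⊆-refl
  ; length-left = n≤1+n _ ; length-right = n≤1+n _
  ; disjoint = Disjoint-if-common-removed ⊆-refl ⊆-refl
      (λ c∈ → case subst (_ ∈_) common c∈ of λ ())
  }
... | a ∷ [] = record
  { left-⊆ = delete-⊆ a A ; right-⊆ = ⊆-refl
  ; length-left = length-delete a uA ; length-right = n≤1+n _
  ; disjoint = Disjoint-if-common-removed (delete-⊆ a A) ⊆-refl
      (λ c∈ → case subst (_ ∈_) common c∈ of λ { (here refl) → inj₁ (∉-delete a A) })
  }
... | a ∷ b ∷ [] = record
  { left-⊆ = delete-⊆ a A ; right-⊆ = delete-⊆ b B
  ; length-left = length-delete a uA ; length-right = length-delete b uB
  ; disjoint = Disjoint-if-common-removed (delete-⊆ a A) (delete-⊆ b B)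
      (λ c∈ → case subst (_ ∈_) common c∈ of λ
        { (here refl)         → inj₁ (∉-delete a A)
        ; (there (here refl)) → inj₂ (∉-delete b B) })
  }
separate uA uB (s≤s (s≤s ())) | _ ∷ _ ∷ _ ∷ _

IsFSListAssignment-restrict :
  ∀ {n} {G G′ : Graph n} {f f′ : Fin n → ℕ} {s} {L L′ : ListAssignment n} →
  (∀ {u v} → Adj G u v → Adj G′ u v) → (∀ v → f v ≡ 1 → f′ v ≡ 1) →
  (∀ v → L′ v ⊆ L v) → (∀ v → f v ≤ length (L′ v)) →
  IsFSListAssignment G′ f′ s L → IsFSListAssignment G f s L′
IsFSListAssignment-restrict G⊆G′ one⇒one L′⊆L f≤|L′| isL = record
  { distinct = λ v → Unique-resp-⊆ (L′⊆L v) (distinct v)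
  ; size     = f≤|L′|
  ; smallInt = λ u v uv →
      ≤-trans (interSize-mono (L′⊆L u) (lookup (L′⊆L v))) (smallInt u v (G⊆G′ uv))
  ; disjoint = λ u v uv fu≡1 fv≡1 c c∈L′u c∈L′v →
      disjoint u v (G⊆G′ uv) (one⇒one u fu≡1) (one⇒one v fv≡1) c
               (lookup (L′⊆L u) c∈L′u) (lookup (L′⊆L v) c∈L′v)
  }
  where open IsFSListAssignment isL

IsLColouring-addEdge :
  ∀ {n} {G : Graph n} {x y} (x≢y : x ≢ y) {L L′ : ListAssignment n} {φ} →
  (∀ v → L′ v ⊆ L v) → Disjoint (L′ x) (L′ y) →
  IsLColouring G L′ φ → IsLColouring (addEdge G x y x≢y) L φ
IsLColouring-addEdge {G = G} {x} {y} x≢y {L} {L′} {φ} L′⊆L L′x#L′y (φ∈L′ , proper) =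
  (λ v → lookup (L′⊆L v) (φ∈L′ v)) , proper′
  where
  proper′ : ∀ u v → Adj (addEdge G x y x≢y) u v → φ u ≢ φ v
  proper′ u v (inj₁ uv) = proper u v uv
  proper′ _ _ (inj₂ (inj₁ (refl , refl))) φx≡φy =
    L′x#L′y (φ∈L′ x , subst (_∈ L′ y) (sym φx≡φy) (φ∈L′ y))
  proper′ _ _ (inj₂ (inj₂ (refl , refl))) φy≡φx =
    L′x#L′y (φ∈L′ x , subst (_∈ L′ y) φy≡φx (φ∈L′ y))

FSChoosable-addEdge :
  ∀ {n} {G : Graph n} {f f′ : Fin n → ℕ} {x y} (x≢y : x ≢ y) →
  FSChoosable G f 2 → (∀ v → f v ≡ 1 → f′ v ≡ 1) → (∀ v → f v ≤ f′ v) →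
  f x ≤ pred (f′ x) → f y ≤ pred (f′ y) → FSChoosable (addEdge G x y x≢y) f′ 2
FSChoosable-addEdge {n} {G} {f} {f′} {x} {y} x≢y choose one⇒one f≤f′ fx≤ fy≤ L isL =
  proj₁ colouring ,
  IsLColouring-addEdge {G = G} x≢y L′⊆L (subst₂ Disjoint (sym L′-x) (sym L′-y) left#right) (proj₂ colouring)
  where
  open IsFSListAssignment isL
  open Separation (separate (distinct x) (distinct y) (smallInt x y (inj₂ (inj₁ (refl , refl)))))
    renaming (disjoint to left#right)

  L′ : ListAssignment n
  L′ v with v ≟ᶠ x | v ≟ᶠ y
  ... | yes _ | _     = left
  ... | no _  | yes _ = right
  ... | no _  | no _  = L v

  L′-x : L′ x ≡ left
  L′-x with x ≟ᶠ x
  ... | yes _   = refl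
  ... | no x≢x  = ⊥-elim (x≢x refl)

  L′-y : L′ y ≡ right
  L′-y with y ≟ᶠ x | y ≟ᶠ y
  ... | yes y≡x | _      = ⊥-elim (x≢y (sym y≡x))
  ... | no _    | yes _  = refl
  ... | no _    | no y≢y = ⊥-elim (y≢y refl)

  L′⊆L : ∀ v → L′ v ⊆ L v
  L′⊆L v with v ≟ᶠ x | v ≟ᶠ y
  ... | yes refl | _        = left-⊆
  ... | no _     | yes refl = right-⊆
  ... | no _     | no _     = ⊆-refl

  f≤|L′| : ∀ v → f v ≤ length (L′ v)
  f≤|L′| v with v ≟ᶠ x | v ≟ᶠ y
  ... | yes refl | _        = ≤-trans fx≤ (pred-mono-≤ (≤-trans (size x) length-left))
  ... | no _     | yes refl = ≤-trans fy≤ (pred-mono-≤ (≤-trans (size y) length-right))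
  ... | no _     | no _     = ≤-trans (f≤f′ v) (size v)

  colouring : Σ (Fin n → ℕ) (IsLColouring G L′)
  colouring = choose L′ (IsFSListAssignment-restrict inj₁ one⇒one L′⊆L f≤|L′| isL)

fourMinus-ExtPos≢1 : ∀ {e} → ExtPos e → fourMinus e ≢ 1
fourMinus-ExtPos≢1 pos1 ()
fourMinus-ExtPos≢1 pos2 ()
fourMinus-ExtPos≢1 pos∞ ()

pred-fourMinus-decr : ∀ {e} → ExtPos e → pred (fourMinus (decr e)) ≡ fourMinus e
pred-fourMinus-decr pos1 = refl
pred-fourMinus-decr pos2 = refl
pred-fourMinus-decr pos∞ = refl

listSize-X : ∀ {n} (K : Configuration n) {v} → X K v ≡ true → listSize K v ≡ fourMinus (ex K v)
listSize-X K Xv rewrite Xv = refl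

listSize-¬X : ∀ {n} (K : Configuration n) {v} → X K v ≡ false → listSize K v ≡ 1
listSize-¬X K ¬Xv rewrite ¬Xv = refl

listSize-cong : ∀ {n} (K K′ : Configuration n) {v} → X K v ≡ X K′ v → ex K v ≡ ex K′ v →
                listSize K v ≡ listSize K′ v
listSize-cong K K′ {v} X≡ ex≡ = by-X (X K v) refl
  where
  by-X : ∀ b → X K v ≡ b → listSize K v ≡ listSize K′ v
  by-X true  Xv = begin
    listSize K v        ≡⟨ listSize-X K Xv ⟩
    fourMinus (ex K v)  ≡⟨ cong fourMinus ex≡ ⟩
    fourMinus (ex K′ v) ≡⟨ listSize-X K′ (trans (sym X≡) Xv) ⟨
    listSize K′ v       ∎
    where open ≡-Reasoning
  by-X false ¬Xv = trans (listSize-¬X K ¬Xv) (sym (listSize-¬X K′ (trans (sym X≡) ¬Xv)))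

endpoint-or-other : ∀ {n} (v x y : Fin n) → (v ≡ x ⊎ v ≡ y) ⊎ (v ≢ x × v ≢ y)
endpoint-or-other v x y with v ≟ᶠ x | v ≟ᶠ y
... | yes v≡x | _       = inj₁ (inj₁ v≡x)
... | no _    | yes v≡y = inj₁ (inj₂ v≡y)
... | no v≢x  | no v≢y  = inj₂ (v≢x , v≢y)

module _ {n} (K : Configuration n) {x y : Fin n} (x≢y : x ≢ y) where

  private
    K′ : Configuration n
    K′ = addEdgeConf K x y x≢y

  ex-addEdgeConf-endpoint : ∀ {v} → v ≡ x ⊎ v ≡ y → ex K′ v ≡ decr (ex K v)
  ex-addEdgeConf-endpoint (inj₁ refl) with x ≟ᶠ x
  ... | yes _   = refl
  ... | no x≢x  = ⊥-elim (x≢x refl)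
  ex-addEdgeConf-endpoint (inj₂ refl) with y ≟ᶠ x | y ≟ᶠ y
  ... | yes _ | _      = refl
  ... | no _  | yes _  = refl
  ... | no _  | no y≢y = ⊥-elim (y≢y refl)

  ex-addEdgeConf-other : ∀ {v} → v ≢ x → v ≢ y → ex K′ v ≡ ex K v
  ex-addEdgeConf-other {v} v≢x v≢y with v ≟ᶠ x | v ≟ᶠ y
  ... | yes v≡x | _       = ⊥-elim (v≢x v≡x)
  ... | no _    | yes v≡y = ⊥-elim (v≢y v≡y)
  ... | no _    | no _    = refl

  listSize-addEdgeConf-other : ∀ {v} → v ≢ x → v ≢ y → listSize K′ v ≡ listSize K v
  listSize-addEdgeConf-other v≢x v≢y = listSize-cong K′ K refl (ex-addEdgeConf-other v≢x v≢y)

  listSize-addEdgeConf-endpoint : ∀ {v} → v ≡ x ⊎ v ≡ y → X K v ≡ true → ExtPos (ex K v) →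
                                  listSize K v ≡ pred (listSize K′ v)
  listSize-addEdgeConf-endpoint {v} end Xv pos = begin
    listSize K v                     ≡⟨ listSize-X K Xv ⟩
    fourMinus (ex K v)               ≡⟨ pred-fourMinus-decr pos ⟨
    pred (fourMinus (decr (ex K v))) ≡⟨ cong (pred ∘ fourMinus) (ex-addEdgeConf-endpoint end) ⟨
    pred (fourMinus (ex K′ v))       ≡⟨ cong pred (listSize-X K′ Xv) ⟨
    pred (listSize K′ v)             ∎
    where open ≡-Reasoning

lemma3p2 : ∀ {n} (K : Configuration n) → Reducible K →
    (x y : Fin n) → X K x ≡ true → X K y ≡ true →
    (x≢y : x ≢ y) → ¬ Adj (C K) x y →
    ExtPos (ex K x) → ExtPos (ex K y) →
    Reducible (addEdgeConf K x y x≢y)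
lemma3p2 K reducible x y Xx Xy x≢y _ px py =
  FSChoosable-addEdge x≢y reducible one⇒one size≤
    (≤-reflexive (shrinks (inj₁ refl))) (≤-reflexive (shrinks (inj₂ refl)))
  where
  K′ : Configuration _
  K′ = addEdgeConf K x y x≢y

  X-endpoint : ∀ {v} → v ≡ x ⊎ v ≡ y → X K v ≡ true
  X-endpoint (inj₁ refl) = Xx
  X-endpoint (inj₂ refl) = Xy

  ExtPos-endpoint : ∀ {v} → v ≡ x ⊎ v ≡ y → ExtPos (ex K v)
  ExtPos-endpoint (inj₁ refl) = px
  ExtPos-endpoint (inj₂ refl) = py

  shrinks : ∀ {v} → v ≡ x ⊎ v ≡ y → listSize K v ≡ pred (listSize K′ v)
  shrinks end = listSize-addEdgeConf-endpoint K x≢y end (X-endpoint end) (ExtPos-endpoint end)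

  one⇒one : ∀ v → listSize K v ≡ 1 → listSize K′ v ≡ 1
  one⇒one v with endpoint-or-other v x y
  ... | inj₁ end = ⊥-elim ∘ fourMinus-ExtPos≢1 (ExtPos-endpoint end)
                          ∘ trans (sym (listSize-X K (X-endpoint end)))
  ... | inj₂ (v≢x , v≢y) = trans (listSize-addEdgeConf-other K x≢y v≢x v≢y)

  size≤ : ∀ v → listSize K v ≤ listSize K′ v
  size≤ v with endpoint-or-other v x y
  ... | inj₁ end = ≤-trans (≤-reflexive (shrinks end)) pred[n]≤n
  ... | inj₂ (v≢x , v≢y) = ≤-reflexive (sym (listSize-addEdgeConf-other K x≢y v≢x v≢y))
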